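{- Let \((P,\lambda)\) be a marked poset. Every face partition \(\pi\) of \((P,\lambda)\) is \((P,\lambda)\)-compatible and connected, and the induced marking \(\lambda/\pi\) on the quotient marked poset \((P/\pi,\lambda/\pi)\) is strict.
   Context: A marked poset \((P,\lambda)\) is a finite poset \(P\) with an induced subposet \(P^*\subseteq P\) of marked elements and an order-preserving map \(\lambda\colon P^*\to\mathbb{R}\); a marking is strict if \(\lambda(a)<\lambda(b)\) whenever \(a<b\) among marked elements. The marked order polyhedron \(\mathcal{O}(P,\lambda)\subseteq\mathbb{R}^P\) is the set of all \(x\in\mathbb{R}^P\) with \(x_p\le x_q\) whenever \(p\le q\) and \(x_a=\lambda(a)\) for \(a\in P^*\). For \(x\in\mathcal{O}(P,\lambda)\), \(\pi_x\) is the partition of \(P\) into equivalence classes of the transitive closure of "\(p\sim q\) if \(x_p=x_q\) and \(p,q\) comparable"; a face partition is \(\pi_x\) for \(x\) in the relative interior of some non-empty face \(F\) (independent of the choice of \(x\)). A partition is connected if each block is connected as an induced subposet of \(P\); it is \(P\)-compatible if the transitive closure of "\(B\le C\) if \(p\le q\) for some \(p\in B,q\in C\)" is antisymmetric on blocks; it is \((P,\lambda)\)-compatible if it is \(P\)-compatible and \(\lambda(a)\le\lambda(b)\) whenever \(a\in B\cap P^*\), \(b\in C\cap P^*\), \(B\le C\). The quotient \((P/\pi,\lambda/\pi)\) has the blocks as elements with this order, the non-free blocks (those meeting \(P^*\)) as marked elements, and \((\lambda/\pi)(B)=\lambda(a)\) for \(a\in B\cap P^*\). -}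

module Defs where

open import Data.Nat using (ℕ)
open import Data.Fin using (Fin)
open import Data.Bool using (Bool; T)
open import Data.List using (List; []; _∷_)
open import Data.Product using (Σ; ∃; ∃-syntax; _×_; _,_)
open import Data.Sum using (_⊎_)
open import Data.Unit using (⊤)
open import Relation.Nullary using (¬_)
open import Relation.Binary.PropositionalEquality using (_≡_; _≢_)
open import Relation.Binary.Structures using (IsTotalOrder; IsPartialOrder)
open import Relation.Binary.Construct.Closure.ReflexiveTransitive using (Star)
open import Algebra.Structures using (IsCommutativeRing)
open import Function.Bundles using (_⇔_)

-- The real numbers, axiomatised as a Dedekind-complete ordered field.
-- (agda-stdlib has no reals; every such structure is isomorphic to ℝ,
-- so quantifying over all of them is the same as talking about ℝ.)

record RealField : Set₁ where
  infixl 6 _+_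
  infixl 7 _*_
  infix  4 _≤_ _<_
  field
    Carrier : Set
    _+_ _*_ : Carrier → Carrier → Carrier
    -_      : Carrier → Carrier
    0# 1#   : Carrier
    _≤_     : Carrier → Carrier → Set
    isCommutativeRing : IsCommutativeRing _≡_ _+_ _*_ -_ 0# 1#
    0≢1     : 0# ≢ 1#
    inverse : ∀ a → a ≢ 0# → ∃[ b ] (a * b ≡ 1#)
    isTotalOrder : IsTotalOrder _≡_ _≤_
    +-mono-≤ : ∀ {a b} c → a ≤ b → a + c ≤ b + c
    *-nonneg : ∀ {a b} → 0# ≤ a → 0# ≤ b → 0# ≤ a * b
    complete : (S : Carrier → Set) → ∃[ s ] S s → ∃[ b ] (∀ s → S s → s ≤ b) →
               ∃[ u ] ((∀ s → S s → s ≤ u) × (∀ b → (∀ s → S s → s ≤ b) → u ≤ b))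

  _<_ : Carrier → Carrier → Set
  a < b = (a ≤ b) × (a ≢ b)

  _-_ : Carrier → Carrier → Carrier
  a - b = a + (- b)

-- P is the finite set Fin n with a partial order;
-- the marked elements P* are given by a Boolean predicate and the
-- marking λ is a map Fin n → ℝ of which only the values on P* matter.

record MarkedPoset (ℝ : RealField) : Set₁ where
  open RealField ℝ
  field
    n       : ℕ
    _≼_     : Fin n → Fin n → Set
    isPartialOrder : IsPartialOrder _≡_ _≼_
    marked  : Fin n → Bool
    mark    : Fin n → Carrier
    mark-mono : ∀ {a b} → T (marked a) → T (marked b) → a ≼ b → mark a ≤ mark b

module _ {ℝ : RealField} (M : MarkedPoset ℝ) where
  open RealField ℝ
  open MarkedPoset M

  Point : Set
  Point = Fin n → Carrier

  Comparable : Fin n → Fin n → Set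
  Comparable p q = (p ≼ q) ⊎ (q ≼ p)

  InPolyhedron : Point → Set
  InPolyhedron x = (∀ p q → p ≼ q → x p ≤ x q) × (∀ a → T (marked a) → x a ≡ mark a)

  sumFin : ∀ {m} → (Fin m → Carrier) → Carrier
  sumFin {ℕ.zero}  f = 0#
  sumFin {ℕ.suc m} f = f Fin.zero + sumFin (λ i → f (Fin.suc i))

  dot : Point → Point → Carrier
  dot c x = sumFin (λ p → c p * x p)

  ValidIneq : Point → Carrier → Set
  ValidIneq c δ = ∀ y → InPolyhedron y → dot c y ≤ δ

  -- the face cut out by a valid inequality: O(P,λ) ∩ {c · y = δ}
  -- (every face of the polyhedron arises this way; c = 0, δ = 0 gives O(P,λ))
  InFace : Point → Carrier → Point → Set
  InFace c δ y = InPolyhedron y × (dot c y ≡ δ)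

  AffComb : List (Carrier × Point) → Point
  AffComb []             p = 0#
  AffComb ((t , z) ∷ ws) p = t * z p + AffComb ws p

  weightSum : List (Carrier × Point) → Carrier
  weightSum []             = 0#
  weightSum ((t , z) ∷ ws) = t + weightSum ws

  AllIn : (Point → Set) → List (Carrier × Point) → Set
  AllIn S []             = ⊤
  AllIn S ((t , z) ∷ ws) = S z × AllIn S ws

  InAffineHull : (Point → Set) → Point → Set
  InAffineHull S y = ∃[ ws ] (AllIn S ws × (weightSum ws ≡ 1#) × (∀ p → AffComb ws p ≡ y p))

  InRelInt : (Point → Set) → Point → Set
  InRelInt S x = S x × ∃[ ε ] ((0# < ε) ×
    (∀ y → InAffineHull S y → (∀ p → ((- ε) < (y p - x p)) × ((y p - x p) < ε)) → S y))

  SameVal : Point → Fin n → Fin n → Set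
  SameVal x p q = (x p ≡ x q) × Comparable p q

  IsFacePartition : (Fin n → Fin n → Set) → Set
  IsFacePartition R = ∃[ c ] ∃[ δ ] (ValidIneq c δ × ∃[ x ] (InRelInt (InFace c δ) x ×
    (∀ p q → R p q ⇔ Star (SameVal x) p q)))

  -- partitions are represented by their "same block" relation R;
  -- the block of p is {q | R p q}.
  module _ (R : Fin n → Fin n → Set) where

    Connected : Set
    Connected = ∀ p q → R p q →
      Star (λ a b → R p a × R p b × Comparable a b) p q

    -- B ≤ C if p ≤ q for some p ∈ B, q ∈ C  (blocks given by representatives)
    BlockLeq : Fin n → Fin n → Set
    BlockLeq p q = ∃[ p' ] ∃[ q' ] (R p p' × R q q' × p' ≼ q')

    BlockLe* : Fin n → Fin n → Set
    BlockLe* = Star BlockLeq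

    PCompatible : Set
    PCompatible = ∀ p q → BlockLe* p q → BlockLe* q p → R p q

    PλCompatible : Set
    PλCompatible = PCompatible ×
      (∀ a b → T (marked a) → T (marked b) → BlockLe* a b → mark a ≤ mark b)

    QuotientMarkingStrict : Set
    QuotientMarkingStrict = ∀ a b → T (marked a) → T (marked b) →
      BlockLe* a b → ¬ R a b → mark a < mark b

-- Only a point x of the face matters, not the relative-interior condition. x is monotone and
-- constant on the blocks of π_x, so a chain of blocks B ≤ ... ≤ C forces x_B ≤ x_C. If moreover
-- x_C ≤ x_B, every step of the chain is an equality between comparable elements, so B = C; this
-- gives compatibility, and, since x equals λ on marked elements, also the strictness of λ/π.
-- Connectedness holds because π_x is generated by comparabilities.
module Submission where

open import Defs
open import Data.Bool using (T)
open import Data.Product using (_×_; _,_; proj₁; proj₂)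
open import Data.Fin using (Fin)
open import Data.Sum using (inj₁; inj₂)
open import Relation.Binary.PropositionalEquality using (_≡_; refl; sym; trans; subst₂; module ≡-Reasoning)
open import Relation.Binary.Construct.Closure.ReflexiveTransitive using (Star; ε; _◅_; _◅◅_; reverse; map)
open import Relation.Binary.Structures using (IsTotalOrder)
open import Function using (_∘_)
open import Function.Bundles using (_⇔_; Equivalence)

module PointPartition {ℝ : RealField} (M : MarkedPoset ℝ) where
  open RealField ℝ
  open MarkedPoset M
  open IsTotalOrder isTotalOrder using () renaming (refl to ≤-refl; trans to ≤-trans; antisym to ≤-antisym)

  ≤-reflexive : ∀ {a b} → a ≡ b → a ≤ b
  ≤-reflexive refl = ≤-refl

  module _ (x : Point M) where

    π : Fin n → Fin n → Set
    π = Star (SameVal M x)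

    π-constant : ∀ {p q} → π p q → x p ≡ x q
    π-constant ε = refl
    π-constant ((e , _) ◅ r) = trans e (π-constant r)

    π-sym : ∀ {p q} → π p q → π q p
    π-sym = reverse λ { (e , inj₁ l) → sym e , inj₂ l ; (e , inj₂ l) → sym e , inj₁ l }

    π-path-in-block : ∀ {p a q} → π p a → π a q →
                      Star (λ u v → π p u × π p v × Comparable M u v) a q
    π-path-in-block p→a ε = ε
    π-path-in-block p→a (s ◅ a→q) =
      (p→a , p→a′ , proj₂ s) ◅ π-path-in-block p→a′ a→q
      where p→a′ = p→a ◅◅ (s ◅ ε)

    π-connected : Connected M π
    π-connected p q = π-path-in-block ε

    module _ (x-mono : ∀ p q → p ≼ q → x p ≤ x q) where

      blockLe*-mono : ∀ {p q} → BlockLe* M π p q → x p ≤ x q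
      blockLe*-mono ε = ≤-refl
      blockLe*-mono ((p′ , q′ , p~p′ , q~q′ , p′≼q′) ◅ r) =
        ≤-trans (≤-reflexive (π-constant p~p′))
          (≤-trans (x-mono _ _ p′≼q′)
            (≤-trans (≤-reflexive (sym (π-constant q~q′))) (blockLe*-mono r)))

      -- x_p ≤ x_m ≤ x_q ≤ x_p squeezes the first step p′ ≼ m′ into an equality.
      blockLe*-reverse⇒π : ∀ {p q} → BlockLe* M π p q → x q ≤ x p → π p q
      blockLe*-reverse⇒π ε _ = ε
      blockLe*-reverse⇒π (step@(p′ , m′ , p~p′ , m~m′ , p′≼m′) ◅ r) xq≤xp =
        p~p′ ◅◅ ((x-p′≡m′ , inj₁ p′≼m′) ◅ π-sym m~m′) ◅◅ blockLe*-reverse⇒π r (≤-trans xq≤xp xp≤xm)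
        where
          xp≤xm = blockLe*-mono (step ◅ ε)
          xp≡xm = ≤-antisym xp≤xm (≤-trans (blockLe*-mono r) xq≤xp)
          x-p′≡m′ = trans (sym (π-constant p~p′)) (trans xp≡xm (π-constant m~m′))

  module _ (x : Point M) (x∈O : InPolyhedron M x) where
    private
      x-mono = proj₁ x∈O
      x-marked = proj₂ x∈O

      blockLe*-mark-mono : ∀ {a b} (ma : T (marked a)) (mb : T (marked b)) →
                           BlockLe* M (π x) a b → mark a ≤ mark b
      blockLe*-mark-mono ma mb = subst₂ _≤_ (x-marked _ ma) (x-marked _ mb) ∘ blockLe*-mono x x-mono

    π-PλCompatible : PλCompatible M (π x)
    π-PλCompatible =
      (λ p q p≤q q≤p → blockLe*-reverse⇒π x x-mono p≤q (blockLe*-mono x x-mono q≤p))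
      , λ a b → blockLe*-mark-mono

    π-quotientMarkingStrict : QuotientMarkingStrict M (π x)
    π-quotientMarkingStrict a b ma mb a≤b a≁b =
      blockLe*-mark-mono ma mb a≤b
      , λ λa≡λb → a≁b (blockLe*-reverse⇒π x x-mono a≤b (≤-reflexive (begin
          x b    ≡⟨ x-marked b mb ⟩
          mark b ≡⟨ sym λa≡λb ⟩
          mark a ≡⟨ sym (x-marked a ma) ⟩
          x a    ∎)))
      where open ≡-Reasoning

module PartitionEquivalence {ℝ : RealField} (M : MarkedPoset ℝ) where
  open MarkedPoset M

  module _ {R R′ : Fin n → Fin n → Set} (R⇔R′ : ∀ p q → R p q ⇔ R′ p q) where
    private
      to : ∀ {p q} → R p q → R′ p q
      to = Equivalence.to (R⇔R′ _ _)

      from : ∀ {p q} → R′ p q → R p q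
      from = Equivalence.from (R⇔R′ _ _)

    blockLe*-⇔ : ∀ {p q} → BlockLe* M R p q → BlockLe* M R′ p q
    blockLe*-⇔ = map λ { (p′ , q′ , p~p′ , q~q′ , p′≼q′) → p′ , q′ , to p~p′ , to q~q′ , p′≼q′ }

    connected-⇔ : Connected M R′ → Connected M R
    connected-⇔ conn p q p~q =
      map (λ { (p~a , p~b , a≍b) → from p~a , from p~b , a≍b }) (conn p q (to p~q))

    pλCompatible-⇔ : PλCompatible M R′ → PλCompatible M R
    pλCompatible-⇔ (compat , mark-mono*) =
      (λ p q p≤q q≤p → from (compat p q (blockLe*-⇔ p≤q) (blockLe*-⇔ q≤p)))
      , λ a b ma mb → mark-mono* a b ma mb ∘ blockLe*-⇔

    quotientMarkingStrict-⇔ : QuotientMarkingStrict M R′ → QuotientMarkingStrict M R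
    quotientMarkingStrict-⇔ strict a b ma mb a≤b a≁b =
      strict a b ma mb (blockLe*-⇔ a≤b) (a≁b ∘ from)

proposition3p10 : {ℝ : RealField} (M : MarkedPoset ℝ) (R : Fin (MarkedPoset.n M) → Fin (MarkedPoset.n M) → Set) →
    IsFacePartition M R → PλCompatible M R × Connected M R × QuotientMarkingStrict M R
proposition3p10 M R (_ , _ , _ , x , ((x∈O , _) , _) , R⇔πₓ) =
  pλCompatible-⇔ R⇔πₓ (π-PλCompatible x x∈O)
  , connected-⇔ R⇔πₓ (π-connected x)
  , quotientMarkingStrict-⇔ R⇔πₓ (π-quotientMarkingStrict x x∈O)
  where
    open PointPartition M
    open PartitionEquivalence M
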